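{- For all $k_c,l_d\in\mathbb Z_{\mathcal S}$ with $k_c\ge l_d$, one has $k_c\gg_\rho l_d$ if and only if there is no path in $\mathbb Z_{\mathcal S}$ containing both $k_c$ and $l_d$.
   Context: $m\ge1$, $\mathcal O=\{1<\dots<m\}$, $\chi$ = truth value. Primary-coloured integers $k_{c_u}$, $k_{c_u}\ge l_{c_v}$ iff $k-l\ge\chi(u<v)$, $k_{c_u}>l_{c_v}$ iff $k-l\ge\chi(u\le v)$; $k_c+1=(k+1)_c$. $succ(k_{c_u})=k_{c_{u+1}}$ ($u<m$), $succ(k_{c_m})=(k+1)_{c_1}$. Secondary-coloured integers $k_{c_{x,y}}$ ($x\le y$) form $\mathbb Z_{\mathcal S}$, $\eta(2k_{c_{x,y}})=k_{c_y}$, $\zeta(2k_{c_{x,y}})=k_{c_x}$, $\eta((2k+1)_{c_{x,y}})=(k+1)_{c_x}$, $\zeta((2k+1)_{c_{x,y}})=k_{c_y}$; each pair $(a,b)$ with $b\le a\le b+1$ is $(\eta(e),\zeta(e))$ for a unique $e$, and $\eta(e)=succ^u(\zeta(e))$ for a unique $u\in\{0,\dots,m\}$. Order: $e\ge e'$ iff $\eta(e)>\eta(e')$ or ($\eta(e)=\eta(e')$ and $\zeta(e)\le\zeta(e')$). For $e$ with $u\le m-1$: $d(e)$ has $\eta=\eta(e)$, $\zeta=succ^{ -1}(\zeta(e))$; $f(e)$ has $\eta=succ(\eta(e))$, $\zeta=\zeta(e)$. A path is $(e_0,\dots,e_m)$ in $\mathbb Z_{\mathcal S}$ with $e_{j+1}\in\{d(e_j),f(e_j)\}$.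 $\rho(c_{x',y'},c_{x,y})=\chi(x\ge x')+\chi(y\ge y')-\chi(y\ge y'>x\ge x')$ and $k_c\gg_\rho l_d$ iff $k-l\ge\rho(c,d)$. -}

module Defs where

open import Data.Nat as ℕ using (ℕ; NonZero)
import Data.Nat.Properties as ℕP
open import Data.Fin as Fin using (Fin; toℕ; fromℕ<)
open import Data.Fin.Properties using (toℕ<n)
open import Data.Integer as ℤ using (ℤ; +_)
open import Data.Integer.DivMod using (_/ℕ_; _%ℕ_)
open import Data.Product using (Σ; ∃; _×_; _,_)
open import Data.Product.Properties using () 
open import Relation.Nullary.Decidable using (Dec; yes; no; does; _×-dec_)
open import Relation.Binary.PropositionalEquality using (_≡_)
open import Data.Sum using (_⊎_)
open import Data.Bool using (if_then_else_)

χ : ∀ {p} {P : Set p} → Dec P → ℤ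
χ d = if does d then + 1 else + 0

module _ (m : ℕ) where

  -- colour c_u, u ∈ {1,…,m}, is represented by Fin m (0-based, same order)
  -- primary-coloured integer k_{c_u}
  Prim : Set
  Prim = ℤ × Fin m

  _≥P_ : Prim → Prim → Set
  (k , u) ≥P (l , v) = χ (u Fin.<? v) ℤ.≤ k ℤ.- l

  _>P_ : Prim → Prim → Set
  (k , u) >P (l , v) = χ (u Fin.≤? v) ℤ.≤ k ℤ.- l

  succ : Prim → Prim
  succ (k , u) with ℕ.suc (toℕ u) ℕ.<? m
  ... | yes p = k , fromℕ< p
  ... | no _  = k ℤ.+ + 1 , fromℕ< {0} (ℕP.≤-<-trans ℕ.z≤n (toℕ<n u))

  record Sec : Set where
    constructor sec
    field
      n    : ℤ
      x    : Fin m
      y    : Fin m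
      .x≤y : x Fin.≤ y

  η : Sec → Prim
  η (sec n x y _) with n %ℕ 2
  ... | ℕ.zero  = n /ℕ 2 , y
  ... | ℕ.suc _ = n /ℕ 2 ℤ.+ + 1 , x

  ζ : Sec → Prim
  ζ (sec n x y _) with n %ℕ 2
  ... | ℕ.zero  = n /ℕ 2 , x
  ... | ℕ.suc _ = n /ℕ 2 , y

  _≥S_ : Sec → Sec → Set
  e ≥S e' = (η e >P η e') ⊎ ((η e ≡ η e') × (ζ e' ≥P ζ e))

  IsD : Sec → Sec → Set
  IsD e e' = (η e' ≡ η e) × (succ (ζ e') ≡ ζ e)

  IsF : Sec → Sec → Set
  IsF e e' = (η e' ≡ succ (η e)) × (ζ e' ≡ ζ e)

  record Path : Set where
    field
      node : Fin (ℕ.suc m) → Sec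
      step : (j : Fin m) →
             IsD (node (Fin.inject₁ j)) (node (Fin.suc j))
             ⊎ IsF (node (Fin.inject₁ j)) (node (Fin.suc j))

  _∈Path_ : Sec → Path → Set
  e ∈Path P = ∃ λ j → Path.node P j ≡ e

  ρ : (Fin m × Fin m) → (Fin m × Fin m) → ℤ
  ρ (x' , y') (x , y) =
    χ (x' Fin.≤? x) ℤ.+ χ (y' Fin.≤? y)
      ℤ.- χ ((y' Fin.≤? y) ×-dec ((x Fin.<? y') ×-dec (x' Fin.≤? x)))

  _≫ρ_ : Sec → Sec → Set
  sec k x' y' _ ≫ρ sec l x y _ = ρ (x' , y') (x , y) ℤ.≤ k ℤ.- l

-- Write a primary-coloured integer k_{c_u} as the integer k·m + u: this is an order embedding
-- taking succ to +1. A secondary-coloured integer e then becomes the interval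
-- [lower e, upper e] = [index ζ(e), index η(e)] of length at most m, which determines e;
-- d(e) moves the lower end down by one and f(e) moves the upper end up by one. So the
-- intervals along a path are nested increasingly, and two elements share a path iff one
-- interval contains the other (for the converse, walk from the inner to the outer interval
-- by a monotone lattice path). Given e ≥ e', hence upper e' ≤ upper e, no common path means
-- that both ends of e lie strictly above those of e', and a case analysis on the parities of
-- the two integers shows that this is exactly k − l ≥ ρ(c, d).
module Submission where

open import Defs
open import Level using (Level)
open import Data.Nat as ℕ using (ℕ; suc; _≥_; s≤s; z≤n; _∸_; _⊓_)
import Data.Nat.Properties as ℕP
open import Data.Integer as ℤ using (ℤ; +_; -[1+_]; +≤+; +<+; -<+; _≤_; _<_; _+_; _-_; -_; _*_; _⊖_)
import Data.Integer.Properties as ℤP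
open import Data.Integer.DivMod using (_/ℕ_; _%ℕ_; n%ℕd<d; a≡a%ℕn+[a/ℕn]*n)
open import Data.Integer.Tactic.RingSolver using (solve; solve-∀)
open import Data.Fin as Fin using (Fin; toℕ; fromℕ<; inject₁)
open import Data.Fin.Properties using (toℕ<n; toℕ-fromℕ<; toℕ-inject₁; toℕ-injective; ≤-total)
open import Data.List using ([]; _∷_)
open import Data.Product using (Σ; ∃; _×_; _,_; proj₁; proj₂; swap; uncurry)
open import Data.Product.Function.NonDependent.Propositional using (_×-⇔_)
open import Data.Sum using (_⊎_; inj₁; inj₂)
open import Data.Empty using (⊥-elim)
open import Function using (_∘_)
open import Function.Bundles using (_⇔_; mk⇔; Equivalence)
open import Function.Construct.Composition using (_⇔-∘_)
open import Relation.Nullary using (¬_; Dec; yes; no; _×-dec_)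
open import Relation.Nullary.Decidable using (decidable-stable; recompute)
open import Relation.Binary.Core using (Rel)
open import Relation.Binary.Definitions using (Reflexive; Transitive)
open import Relation.Binary.PropositionalEquality
open import Algebra.Properties.AbelianGroup ℤP.+-0-abelianGroup using () renaming (∙-cancelʳ to +-cancelʳ)

private variable
  p : Level
  P Q S : Set p

χ-nonNeg : (d : Dec P) → + 0 ≤ χ d
χ-nonNeg (yes _) = +≤+ z≤n
χ-nonNeg (no _)  = +≤+ z≤n

χ≤1 : (d : Dec P) → χ d ≤ + 1
χ≤1 (yes _) = +≤+ (s≤s z≤n)
χ≤1 (no _)  = +≤+ z≤n

χ≤0⇔¬ : (d : Dec P) → χ d ≤ + 0 ⇔ (¬ P)
χ≤0⇔¬ (yes x) = mk⇔ (λ { (+≤+ ()) }) (λ ¬x → ⊥-elim (¬x x))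
χ≤0⇔¬ (no ¬x) = mk⇔ (λ _ → ¬x) (λ _ → +≤+ z≤n)

0≤i⇒i≰-[1+n] : ∀ {i n} → + 0 ≤ i → ¬ (i ≤ -[1+ n ])
0≤i⇒i≰-[1+n] 0≤i i≤- with ℤP.≤-trans 0≤i i≤-
... | ()

-- Away from V = 0 both sides are settled by 0 ≤ R ≤ 2 and 0 ≤ χ ≤ 1.
threshold : ∀ {s U V R} (x : Dec P) (y : Dec Q) → s ℕ.≤ 1 → + 0 ≤ R × R ≤ + 2 →
            R ≤ + s ⇔ (χ x ≤ + s × χ y ≤ + 0) → U ≡ V + + s →
            R ≤ U + V ⇔ (χ x ≤ U × χ y ≤ V)
threshold {V = + 0} _ _ z≤n       _ at-0 refl = at-0
threshold {V = + 0} _ _ (s≤s z≤n) _ at-0 refl = at-0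
threshold {s = s} {V = + suc j} x y _ (_ , R≤2) _ refl = mk⇔
  (λ _ → ℤP.≤-trans (χ≤1 x) (+≤+ (s≤s z≤n)) , ℤP.≤-trans (χ≤1 y) (+≤+ (s≤s z≤n)))
  (λ _ → ℤP.≤-trans R≤2 (+≤+ (s≤s (ℕP.≤-trans (s≤s z≤n) (ℕP.m≤n+m (suc j) (j ℕ.+ s))))))
threshold {V = -[1+ j ]} _ y z≤n (0≤R , _) _ refl = mk⇔
  (⊥-elim ∘ 0≤i⇒i≰-[1+n] 0≤R) (⊥-elim ∘ 0≤i⇒i≰-[1+n] (χ-nonNeg y) ∘ proj₂)
threshold {V = -[1+ 0 ]} _ y (s≤s z≤n) (0≤R , _) _ refl = mk⇔
  (⊥-elim ∘ 0≤i⇒i≰-[1+n] 0≤R) (⊥-elim ∘ 0≤i⇒i≰-[1+n] (χ-nonNeg y) ∘ proj₂)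
threshold {V = -[1+ suc j ]} _ y (s≤s z≤n) (0≤R , _) _ refl = mk⇔
  (⊥-elim ∘ 0≤i⇒i≰-[1+n] 0≤R) (⊥-elim ∘ 0≤i⇒i≰-[1+n] (χ-nonNeg y) ∘ proj₂)

-- ρ m (x' , y') (x , y) is by definition inclusionExclusion (x' ≤? x) (y' ≤? y) (x <? y').
inclusionExclusion : Dec P → Dec Q → Dec S → ℤ
inclusionExclusion a b c = χ a + χ b - χ (b ×-dec (c ×-dec a))

ie-bounds : (a : Dec P) (b : Dec Q) (c : Dec S) →
            + 0 ≤ inclusionExclusion a b c × inclusionExclusion a b c ≤ + 2
ie-bounds (yes _) (yes _) (yes _) = +≤+ z≤n , +≤+ (s≤s z≤n)
ie-bounds (yes _) (yes _) (no _)  = +≤+ z≤n , +≤+ (s≤s (s≤s z≤n))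
ie-bounds (yes _) (no _)  _       = +≤+ z≤n , +≤+ (s≤s z≤n)
ie-bounds (no _)  (yes _) (yes _) = +≤+ z≤n , +≤+ (s≤s z≤n)
ie-bounds (no _)  (yes _) (no _)  = +≤+ z≤n , +≤+ (s≤s z≤n)
ie-bounds (no _)  (no _)  _       = +≤+ z≤n , +≤+ z≤n

ie≤0⇔ : (a : Dec P) (b : Dec Q) (c : Dec S) →
        inclusionExclusion a b c ≤ + 0 ⇔ (χ a ≤ + 0 × χ b ≤ + 0)
ie≤0⇔ (yes _) (yes _) (yes _) = mk⇔ (λ { (+≤+ ()) }) (λ { (+≤+ () , _) })
ie≤0⇔ (yes _) (yes _) (no _)  = mk⇔ (λ { (+≤+ ()) }) (λ { (+≤+ () , _) })
ie≤0⇔ (yes _) (no _)  _       = mk⇔ (λ { (+≤+ ()) }) (λ { (+≤+ () , _) })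
ie≤0⇔ (no _)  (yes _) (yes _) = mk⇔ (λ { (+≤+ ()) }) (λ { (_ , +≤+ ()) })
ie≤0⇔ (no _)  (yes _) (no _)  = mk⇔ (λ { (+≤+ ()) }) (λ { (_ , +≤+ ()) })
ie≤0⇔ (no _)  (no _)  _       = mk⇔ (λ _ → +≤+ z≤n , +≤+ z≤n) (λ _ → +≤+ z≤n)

ie≤1⇔ : (a : Dec P) (b : Dec Q) (c : Dec S) → (¬ S → P × Q) →
        inclusionExclusion a b c ≤ + 1 ⇔ S
ie≤1⇔ a b (yes s) _ = mk⇔ (λ _ → s) (λ _ → ie≤1 a b)
  where
  ie≤1 : (a : Dec P) (b : Dec Q) → inclusionExclusion a b (yes s) ≤ + 1
  ie≤1 (yes _) (yes _) = +≤+ (s≤s z≤n)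
  ie≤1 (yes _) (no _)  = +≤+ (s≤s z≤n)
  ie≤1 (no _)  (yes _) = +≤+ (s≤s z≤n)
  ie≤1 (no _)  (no _)  = +≤+ z≤n
ie≤1⇔ (yes _) (yes _) (no ¬s) _     = mk⇔ (λ { (+≤+ (s≤s ())) }) (⊥-elim ∘ ¬s)
ie≤1⇔ (yes _) (no ¬q) (no ¬s) ¬S⇒PQ = ⊥-elim (¬q (proj₂ (¬S⇒PQ ¬s)))
ie≤1⇔ (no ¬p) _       (no ¬s) ¬S⇒PQ = ⊥-elim (¬p (proj₁ (¬S⇒PQ ¬s)))

*2≢1 : ∀ i → i * + 2 ≢ + 1
*2≢1 (+ 0)     ()
*2≢1 (+ suc _) ()
*2≢1 -[1+ _ ]  ()

even≢odd : ∀ k l → k * + 2 ≢ l * + 2 + + 1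
even≢odd k l k*2≡l*2+1 = *2≢1 (k - l) (begin
  (k - l) * + 2           ≡⟨ solve (k ∷ l ∷ []) ⟩
  k * + 2 - l * + 2       ≡⟨ cong (_- l * + 2) k*2≡l*2+1 ⟩
  l * + 2 + + 1 - l * + 2 ≡⟨ solve (l ∷ []) ⟩
  + 1                     ∎)
  where open ≡-Reasoning

[i+1]-[j+1]≡i-j+0 : ∀ i j → (i + + 1) - (j + + 1) ≡ (i - j) + + 0
[i+1]-[j+1]≡i-j+0 = solve-∀

[i+1]-j≡i-j+1 : ∀ i j → (i + + 1) - j ≡ (i - j) + + 1
[i+1]-j≡i-j+1 = solve-∀

i-j≡[i-[j+1]]+1 : ∀ i j → i - j ≡ (i - (j + + 1)) + + 1
i-j≡[i-[j+1]]+1 = solve-∀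

[i+j]-[k+l]≡[i-k]+[j-l] : ∀ i j k l → (i + j) - (k + l) ≡ (i - k) + (j - l)
[i+j]-[k+l]≡[i-k]+[j-l] = solve-∀

-i+[i+j]≡j : ∀ i j → - i + (i + j) ≡ j
-i+[i+j]≡j = solve-∀

k*W+u≡l*W+[[k-l]*W+u] : ∀ k l W u → k * W + u ≡ l * W + ((k - l) * W + u)
k*W+u≡l*W+[[k-l]*W+u] = solve-∀

[k+1]*[1+n]+0≡k*[1+n]+n+1 : ∀ k n → (k + + 1) * (+ 1 + n) + + 0 ≡ k * (+ 1 + n) + n + + 1
[k+1]*[1+n]+0≡k*[1+n]+n+1 = solve-∀

[k+1]*W+x≡k*W+[W+x] : ∀ k W x → (k + + 1) * W + x ≡ k * W + (W + x)
[k+1]*W+x≡k*W+[W+x] = solve-∀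

i+[1+j]≡i+j+1 : ∀ i j → i + (+ 1 + j) ≡ i + j + + 1
i+[1+j]≡i+j+1 = solve-∀

i-[1+j]+[1+k]≡i-j+k : ∀ i j k → i - (+ 1 + j) + (+ 1 + k) ≡ i - j + k
i-[1+j]+[1+k]≡i-j+k = solve-∀

i-[1+j]+1≡i-j : ∀ i j → i - (+ 1 + j) + + 1 ≡ i - j
i-[1+j]+1≡i-j = solve-∀

j≡i+[j-i] : ∀ i j → j ≡ i + (j - i)
j≡i+[j-i] = solve-∀

i≡[i+j]-j : ∀ i j → i ≡ (i + j) - j
i≡[i+j]-j = solve-∀

z+a+c≡z-b+[a+[b+c]] : ∀ z a b c → z + a + c ≡ z - b + (a + (b + c))
z+a+c≡z-b+[a+[b+c]] = solve-∀

i≢i+1 : ∀ {i} → i ≢ i + + 1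
i≢i+1 {i} i≡i+1 = ℤP.i≢suc[i] (trans i≡i+1 (ℤP.+-comm i (+ 1)))

+-monoʳ-≤-⇔ : ∀ k {i j} → i ≤ j ⇔ k + i ≤ k + j
+-monoʳ-≤-⇔ k {i} {j} =
  mk⇔ (ℤP.+-monoʳ-≤ k) (subst₂ _≤_ (-i+[i+j]≡j k i) (-i+[i+j]≡j k j) ∘ ℤP.+-monoʳ-≤ (- k))

+-monoʳ-<-⇔ : ∀ k {i j} → i < j ⇔ k + i < k + j
+-monoʳ-<-⇔ k {i} {j} =
  mk⇔ (ℤP.+-monoʳ-< k) (subst₂ _<_ (-i+[i+j]≡j k i) (-i+[i+j]≡j k j) ∘ ℤP.+-monoʳ-< (- k))

u⊖[1+N]<0 : ∀ {u N} → u ℕ.≤ N → u ⊖ suc N < + 0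
u⊖[1+N]<0 {u} {N} u≤N rewrite ℤP.⊖-< (s≤s u≤N) | ℕP.+-∸-assoc 1 u≤N = -<+

∃-gap : ∀ {i j} → i ≤ j → ∃ λ d → j ≡ i + + d
∃-gap {i} {j} i≤j = ℤ.∣ i - j ∣ , trans (j≡i+[j-i] i j) (cong (_+_ i) (sym (ℤP.∣-∣-≤ i≤j)))

UnitSteps : (ℕ → ℕ) → Set
UnitSteps g = ∀ t → g (suc t) ≡ g t ⊎ g (suc t) ≡ suc (g t)

∸-unitSteps : ∀ A → UnitSteps (_∸ A)
∸-unitSteps ℕ.zero    t       = inj₂ refl
∸-unitSteps (suc A)   ℕ.zero  = inj₁ (ℕP.0∸n≡0 A)
∸-unitSteps (suc A)   (suc t) = ∸-unitSteps A t

⊓-unitSteps : ∀ B → UnitSteps (_⊓ B)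
⊓-unitSteps ℕ.zero  ℕ.zero  = inj₁ refl
⊓-unitSteps ℕ.zero  (suc _) = inj₁ refl
⊓-unitSteps (suc B) ℕ.zero  = inj₂ refl
⊓-unitSteps (suc B) (suc t) with ⊓-unitSteps B t
... | inj₁ eq = inj₁ (cong suc eq)
... | inj₂ eq = inj₂ (cong suc eq)

∘-unitSteps : ∀ {f g} → UnitSteps f → UnitSteps g → UnitSteps (g ∘ f)
∘-unitSteps {f} {g} f-steps g-steps t with f-steps t
... | inj₁ eq = inj₁ (cong g eq)
... | inj₂ eq rewrite eq = g-steps (f t)

module _ {a ℓ} {A : Set a} {_∼_ : Rel A ℓ} (refl∼ : Reflexive _∼_) (trans∼ : Transitive _∼_) where

  stepwise⇒monotone : ∀ {n} (f : Fin (suc n) → A) → (∀ j → f (inject₁ j) ∼ f (Fin.suc j)) →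
                      ∀ {i j} → i Fin.≤ j → f i ∼ f j
  stepwise⇒monotone f _ {Fin.zero} {Fin.zero} _ = refl∼
  stepwise⇒monotone {suc n} f step {Fin.zero} {Fin.suc j} _ =
    trans∼ (step Fin.zero) (stepwise⇒monotone (f ∘ Fin.suc) (step ∘ Fin.suc) {Fin.zero} {j} z≤n)
  stepwise⇒monotone {suc n} f step {Fin.suc i} {Fin.suc j} (s≤s i≤j) =
    stepwise⇒monotone (f ∘ Fin.suc) (step ∘ Fin.suc) i≤j

-- Secondary-coloured integers: parity and the relation ≫ρ

module _ {m : ℕ} where

  data Parity (e : Sec m) : Set where
    even : ∀ k → Sec.n e ≡ k * + 2 →
           η m e ≡ (k , Sec.y e) → ζ m e ≡ (k , Sec.x e) → Parity e
    odd  : ∀ k → Sec.n e ≡ k * + 2 + + 1 →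
           η m e ≡ (k + + 1 , Sec.x e) → ζ m e ≡ (k , Sec.y e) → Parity e

  private
    η,ζ-if-even : ∀ {n x y} .{x≤y : x Fin.≤ y} → n %ℕ 2 ≡ 0 →
                  η m (sec n x y x≤y) ≡ (n /ℕ 2 , y) × ζ m (sec n x y x≤y) ≡ (n /ℕ 2 , x)
    η,ζ-if-even n%2≡0 rewrite n%2≡0 = refl , refl

    η,ζ-if-odd : ∀ {n x y} .{x≤y : x Fin.≤ y} → n %ℕ 2 ≡ 1 →
                 η m (sec n x y x≤y) ≡ (n /ℕ 2 + + 1 , x) × ζ m (sec n x y x≤y) ≡ (n /ℕ 2 , y)
    η,ζ-if-odd n%2≡1 rewrite n%2≡1 = refl , refl

  parity : (e : Sec m) → Parity e
  parity (sec n x y _) with n %ℕ 2 in n%2 | a≡a%ℕn+[a/ℕn]*n n 2 | n%ℕd<d n 2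
  ... | 0           | n≡ | _ = uncurry (even (n /ℕ 2) (trans n≡ (ℤP.+-identityˡ _))) (η,ζ-if-even n%2)
  ... | 1           | n≡ | _ =
    uncurry (odd (n /ℕ 2) (trans n≡ (ℤP.+-comm (+ 1) (n /ℕ 2 * + 2)))) (η,ζ-if-odd n%2)
  ... | suc (suc _) | _  | s≤s (s≤s ())

  n≡η+ζ : (e : Sec m) → Sec.n e ≡ proj₁ (η m e) + proj₁ (ζ m e)
  n≡η+ζ e with parity e
  ... | even k n≡ η≡ ζ≡ rewrite η≡ | ζ≡ = trans n≡ (solve (k ∷ []))
  ... | odd  k n≡ η≡ ζ≡ rewrite η≡ | ζ≡ = trans n≡ (solve (k ∷ []))

  η,ζ-even : ∀ k x y .(x≤y : x Fin.≤ y) →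
             η m (sec (k * + 2) x y x≤y) ≡ (k , y) × ζ m (sec (k * + 2) x y x≤y) ≡ (k , x)
  η,ζ-even k x y x≤y with parity (sec (k * + 2) x y x≤y)
  ... | even l n≡ η≡ ζ≡ rewrite ℤP.*-cancelʳ-≡ k l (+ 2) n≡ = η≡ , ζ≡
  ... | odd  l n≡ _  _  = ⊥-elim (even≢odd k l n≡)

  η,ζ-odd : ∀ k x y .(x≤y : x Fin.≤ y) →
            η m (sec (k * + 2 + + 1) x y x≤y) ≡ (k + + 1 , x) × ζ m (sec (k * + 2 + + 1) x y x≤y) ≡ (k , y)
  η,ζ-odd k x y x≤y with parity (sec (k * + 2 + + 1) x y x≤y)
  ... | odd  l n≡ η≡ ζ≡ rewrite ℤP.*-cancelʳ-≡ k l (+ 2) (+-cancelʳ (+ 1) _ _ n≡) = η≡ , ζ≡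
  ... | even l n≡ _  _  = ⊥-elim (even≢odd l k (sym n≡))

  private
    pairs-agree : ∀ {p p' : Prim m} {k k' c c'} →
                  p ≡ (k , c) → p' ≡ (k' , c') → p ≡ p' → (k , c) ≡ (k' , c')
    pairs-agree refl refl refl = refl

  η,ζ-injective : (e e' : Sec m) → η m e ≡ η m e' → ζ m e ≡ ζ m e' → e ≡ e'
  η,ζ-injective e@(sec n x y _) e'@(sec n' x' y' _) η≡η' ζ≡ζ' with parity e | parity e'
  ... | even k refl η≡ ζ≡ | even k' refl η'≡ ζ'≡
    with pairs-agree η≡ η'≡ η≡η' | pairs-agree ζ≡ ζ'≡ ζ≡ζ'
  ...   | refl | refl = refl
  η,ζ-injective e@(sec n x y _) e'@(sec n' x' y' _) η≡η' ζ≡ζ'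
    | odd k refl η≡ ζ≡ | odd k' refl η'≡ ζ'≡
    with pairs-agree η≡ η'≡ η≡η' | pairs-agree ζ≡ ζ'≡ ζ≡ζ'
  ...   | refl | refl = refl
  η,ζ-injective e e' η≡η' ζ≡ζ' | even k _ η≡ ζ≡ | odd k' _ η'≡ ζ'≡ =
    ⊥-elim (i≢i+1 (trans (sym (cong proj₁ (pairs-agree ζ≡ ζ'≡ ζ≡ζ')))
                         (cong proj₁ (pairs-agree η≡ η'≡ η≡η'))))
  η,ζ-injective e e' η≡η' ζ≡ζ' | odd k _ η≡ ζ≡ | even k' _ η'≡ ζ'≡ =
    ⊥-elim (i≢i+1 (trans (cong proj₁ (pairs-agree ζ≡ ζ'≡ ζ≡ζ'))
                         (sym (cong proj₁ (pairs-agree η≡ η'≡ η≡η')))))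

  _≻_ : Sec m → Sec m → Set
  e ≻ e' = _>P_ m (η m e) (η m e') × _>P_ m (ζ m e) (ζ m e')

  ρ-bounds : (a b a' b' : Fin m) → + 0 ≤ ρ m (a , b) (a' , b') × ρ m (a , b) (a' , b') ≤ + 2
  ρ-bounds a b a' b' = ie-bounds (a Fin.≤? a') (b Fin.≤? b') (a' Fin.<? b)

  ρ≤0⇔ : (a b a' b' : Fin m) →
         ρ m (a , b) (a' , b') ≤ + 0 ⇔ (χ (a Fin.≤? a') ≤ + 0 × χ (b Fin.≤? b') ≤ + 0)
  ρ≤0⇔ a b a' b' = ie≤0⇔ (a Fin.≤? a') (b Fin.≤? b') (a' Fin.<? b)

  ρ≤1⇔ : ∀ {a b a' b' : Fin m} → a Fin.≤ b → a' Fin.≤ b' →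
         ρ m (a , b) (a' , b') ≤ + 1 ⇔ (χ (a Fin.≤? b') ≤ + 1 × χ (b Fin.≤? a') ≤ + 0)
  ρ≤1⇔ {a} {b} {a'} {b'} a≤b a'≤b' =
    a'<b⇔ ⇔-∘ ie≤1⇔ (a Fin.≤? a') (b Fin.≤? b') (a' Fin.<? b) b≤a'⇒
    where
    b≤a'⇒ : ¬ a' Fin.< b → a Fin.≤ a' × b Fin.≤ b'
    b≤a'⇒ a'≮b = ℕP.≤-trans a≤b (ℕP.≮⇒≥ a'≮b) , ℕP.≤-trans (ℕP.≮⇒≥ a'≮b) a'≤b'
    a'<b⇔ : a' Fin.< b ⇔ (χ (a Fin.≤? b') ≤ + 1 × χ (b Fin.≤? a') ≤ + 0)
    a'<b⇔ = mk⇔ (λ a'<b → χ≤1 (a Fin.≤? b') ,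
                             Equivalence.from (χ≤0⇔¬ (b Fin.≤? a')) (ℕP.<⇒≱ a'<b))
                (ℕP.≰⇒> ∘ Equivalence.to (χ≤0⇔¬ (b Fin.≤? a')) ∘ proj₂)

  private
    Δη Δζ : Sec m → Sec m → ℤ
    Δη e e' = proj₁ (η m e) - proj₁ (η m e')
    Δζ e e' = proj₁ (ζ m e) - proj₁ (ζ m e')

  ρ≤Δη+Δζ⇔≻ : (e e' : Sec m) →
              ρ m (Sec.x e , Sec.y e) (Sec.x e' , Sec.y e') ≤ Δη e e' + Δζ e e' ⇔ e ≻ e'
  ρ≤Δη+Δζ⇔≻ e@(sec _ a b a≤b) e'@(sec _ a' b' a'≤b') with parity e | parity e'
  ... | even k _ η≡ ζ≡ | even k' _ η'≡ ζ'≡ rewrite η≡ | ζ≡ | η'≡ | ζ'≡ =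
    threshold (b Fin.≤? b') (a Fin.≤? a') z≤n (ρ-bounds a b a' b')
      (mk⇔ swap swap ⇔-∘ ρ≤0⇔ a b a' b') (sym (ℤP.+-identityʳ _))
  ... | odd k _ η≡ ζ≡ | odd k' _ η'≡ ζ'≡ rewrite η≡ | ζ≡ | η'≡ | ζ'≡ =
    threshold (a Fin.≤? a') (b Fin.≤? b') z≤n (ρ-bounds a b a' b')
      (ρ≤0⇔ a b a' b') ([i+1]-[j+1]≡i-j+0 k k')
  ... | odd k _ η≡ ζ≡ | even k' _ η'≡ ζ'≡ rewrite η≡ | ζ≡ | η'≡ | ζ'≡ =
    threshold (a Fin.≤? b') (b Fin.≤? a') (s≤s z≤n) (ρ-bounds a b a' b')
      (ρ≤1⇔ (recompute (a Fin.≤? b) a≤b) (recompute (a' Fin.≤? b') a'≤b')) ([i+1]-j≡i-j+1 k k')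
  ... | even k _ η≡ ζ≡ | odd k' _ η'≡ ζ'≡ rewrite η≡ | ζ≡ | η'≡ | ζ'≡ =
    -- here the ζ-gap is the larger one, so η and ζ swap roles
    subst (λ Δ → ρ m (a , b) (a' , b') ≤ Δ ⇔
                 (χ (b Fin.≤? a') ≤ k - (k' + + 1) × χ (a Fin.≤? b') ≤ k - k'))
          (ℤP.+-comm (k - k') (k - (k' + + 1)))
      (mk⇔ swap swap ⇔-∘
        threshold (a Fin.≤? b') (b Fin.≤? a') (s≤s z≤n) (ρ-bounds a b a' b')
          (ρ≤1⇔ (recompute (a Fin.≤? b) a≤b) (recompute (a' Fin.≤? b') a'≤b'))
          (i-j≡[i-[j+1]]+1 k k'))

  ≫ρ⇔≻ : (e e' : Sec m) → _≫ρ_ m e e' ⇔ e ≻ e'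
  ≫ρ⇔≻ e e' = subst (λ Δ → ρ m (Sec.x e , Sec.y e) (Sec.x e' , Sec.y e') ≤ Δ ⇔ e ≻ e')
                    (sym n-n'≡Δη+Δζ) (ρ≤Δη+Δζ⇔≻ e e')
    where
    n-n'≡Δη+Δζ : Sec.n e - Sec.n e' ≡ Δη e e' + Δζ e e'
    n-n'≡Δη+Δζ = trans (cong₂ _-_ (n≡η+ζ e) (n≡η+ζ e'))
                       ([i+j]-[k+l]≡[i-k]+[j-l] (proj₁ (η m e)) (proj₁ (ζ m e))
                                                (proj₁ (η m e')) (proj₁ (ζ m e')))

  ≥P-antisym : (p q : Prim m) → _≥P_ m p q → _≥P_ m q p → p ≡ q
  ≥P-antisym (k , u) (l , v) p≥q q≥p =
    cong₂ _,_ k≡l (toℕ-injective (ℕP.≤-antisym (ℕP.≮⇒≥ v≮u) (ℕP.≮⇒≥ u≮v)))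
    where
    k≡l : k ≡ l
    k≡l = ℤP.≤-antisym (ℤP.0≤i-j⇒j≤i (ℤP.≤-trans (χ-nonNeg (v Fin.<? u)) q≥p))
                       (ℤP.0≤i-j⇒j≤i (ℤP.≤-trans (χ-nonNeg (u Fin.<? v)) p≥q))
    u≮v : ¬ u Fin.< v
    u≮v = Equivalence.to (χ≤0⇔¬ (u Fin.<? v)) (subst (χ (u Fin.<? v) ≤_) (ℤP.i≡j⇒i-j≡0 k≡l) p≥q)
    v≮u : ¬ v Fin.< u
    v≮u = Equivalence.to (χ≤0⇔¬ (v Fin.<? u)) (subst (χ (v Fin.<? u) ≤_) (ℤP.i≡j⇒i-j≡0 (sym k≡l)) q≥p)

-- Primary-coloured integers as integers, secondary ones as intervals

module _ {m' : ℕ} where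
  private
    M : ℕ
    M = suc m'

  index : Prim M → ℤ
  index (k , u) = k * + M + + toℕ u

  private
    index-splits : ∀ k l (u : Fin M) → index (k , u) ≡ l * + M + ((k - l) * + M + + toℕ u)
    index-splits k l u = k*W+u≡l*W+[[k-l]*W+u] k l (+ M) (+ toℕ u)

    negative-digit : ∀ j (u : Fin M) → -[1+ j ] * + M + + toℕ u < + 0
    negative-digit j u = u⊖[1+N]<0 (ℕP.≤-trans (ℕP.≤-pred (toℕ<n u)) (ℕP.m≤m+n m' (j ℕ.* M)))

    below-positive-digit : ∀ j (u v : Fin M) → toℕ v ℕ.< suc j ℕ.* M ℕ.+ toℕ u
    below-positive-digit j u v =
      ℕP.<-≤-trans (toℕ<n v) (ℕP.≤-trans (ℕP.m≤m+n M (j ℕ.* M)) (ℕP.m≤m+n _ (toℕ u)))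

  digit-≤⇔ : ∀ D (u v : Fin M) → χ (u Fin.<? v) ≤ D ⇔ + toℕ v ≤ D * + M + + toℕ u
  digit-≤⇔ (+ 0) u v =
    mk⇔ (+≤+ ∘ ℕP.≮⇒≥) (ℕP.≤⇒≯ ∘ ℤP.drop‿+≤+) ⇔-∘ χ≤0⇔¬ (u Fin.<? v)
  digit-≤⇔ (+ suc j) u v = mk⇔
    (λ _ → +≤+ (ℕP.<⇒≤ (below-positive-digit j u v)))
    (λ _ → ℤP.≤-trans (χ≤1 (u Fin.<? v)) (+≤+ (s≤s z≤n)))
  digit-≤⇔ -[1+ j ] u v = mk⇔
    (⊥-elim ∘ 0≤i⇒i≰-[1+n] (χ-nonNeg (u Fin.<? v)))
    (λ v≤ → ⊥-elim (ℤP.<⇒≱ (negative-digit j u) (ℤP.≤-trans (+≤+ z≤n) v≤)))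

  digit-<⇔ : ∀ D (u v : Fin M) → χ (u Fin.≤? v) ≤ D ⇔ + toℕ v < D * + M + + toℕ u
  digit-<⇔ (+ 0) u v =
    mk⇔ (+<+ ∘ ℕP.≰⇒>) (ℕP.<⇒≱ ∘ ℤP.drop‿+<+) ⇔-∘ χ≤0⇔¬ (u Fin.≤? v)
  digit-<⇔ (+ suc j) u v = mk⇔
    (λ _ → +<+ (below-positive-digit j u v))
    (λ _ → ℤP.≤-trans (χ≤1 (u Fin.≤? v)) (+≤+ (s≤s z≤n)))
  digit-<⇔ -[1+ j ] u v = mk⇔
    (⊥-elim ∘ 0≤i⇒i≰-[1+n] (χ-nonNeg (u Fin.≤? v)))
    (λ v< → ⊥-elim (ℤP.<⇒≱ (negative-digit j u) (ℤP.<⇒≤ (ℤP.≤-<-trans (+≤+ z≤n) v<))))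

  ≥P⇔index≤ : (p q : Prim M) → _≥P_ M p q ⇔ index q ≤ index p
  ≥P⇔index≤ (k , u) (l , v) =
    subst (λ t → + toℕ v ≤ (k - l) * + M + + toℕ u ⇔ index (l , v) ≤ t) (sym (index-splits k l u))
          (+-monoʳ-≤-⇔ (l * + M))
    ⇔-∘ digit-≤⇔ (k - l) u v

  >P⇔index< : (p q : Prim M) → _>P_ M p q ⇔ index q < index p
  >P⇔index< (k , u) (l , v) =
    subst (λ t → + toℕ v < (k - l) * + M + + toℕ u ⇔ index (l , v) < t) (sym (index-splits k l u))
          (+-monoʳ-<-⇔ (l * + M))
    ⇔-∘ digit-<⇔ (k - l) u v

  index-injective : (p q : Prim M) → index p ≡ index q → p ≡ q
  index-injective p q ip≡iq =
    ≥P-antisym p q (Equivalence.from (≥P⇔index≤ p q) (ℤP.≤-reflexive (sym ip≡iq)))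
                   (Equivalence.from (≥P⇔index≤ q p) (ℤP.≤-reflexive ip≡iq))

  index-succ : (p : Prim M) → index (succ M p) ≡ index p + + 1
  index-succ (k , u) with suc (toℕ u) ℕ.<? M
  ... | yes u+1<M = begin
    k * + M + + toℕ (fromℕ< u+1<M) ≡⟨ cong (λ t → k * + M + + t) u+1≡ ⟩
    k * + M + (+ toℕ u + + 1)       ≡⟨ ℤP.+-assoc (k * + M) (+ toℕ u) (+ 1) ⟨
    k * + M + + toℕ u + + 1         ∎
    where
    open ≡-Reasoning
    u+1≡ : toℕ (fromℕ< u+1<M) ≡ toℕ u ℕ.+ 1
    u+1≡ = trans (toℕ-fromℕ< u+1<M) (ℕP.+-comm 1 (toℕ u))
  ... | no u+1≮M = begin
    (k + + 1) * (+ 1 + + m') + + 0  ≡⟨ [k+1]*[1+n]+0≡k*[1+n]+n+1 k (+ m') ⟩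
    k * (+ 1 + + m') + + m' + + 1   ≡⟨ cong (λ t → k * + M + + t + + 1) u≡m' ⟨
    k * + M + + toℕ u + + 1         ∎
    where
    open ≡-Reasoning
    u≡m' : toℕ u ≡ m'
    u≡m' = ℕP.≤-antisym (ℕP.≤-pred (toℕ<n u)) (ℕP.≤-pred (ℕP.≮⇒≥ u+1≮M))

  index-surjective : (z : ℤ) → Σ (Prim M) λ p → index p ≡ z
  index-surjective z = (z /ℕ M , fromℕ< (n%ℕd<d z M)) , (begin
    z /ℕ M * + M + + toℕ (fromℕ< (n%ℕd<d z M)) ≡⟨ cong (λ t → z /ℕ M * + M + + t) (toℕ-fromℕ< _) ⟩
    z /ℕ M * + M + + (z %ℕ M)                  ≡⟨ ℤP.+-comm (z /ℕ M * + M) (+ (z %ℕ M)) ⟩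
    + (z %ℕ M) + z /ℕ M * + M                  ≡⟨ a≡a%ℕn+[a/ℕn]*n z M ⟨
    z                                          ∎)
    where open ≡-Reasoning

  upper lower : Sec M → ℤ
  upper e = index (η M e)
  lower e = index (ζ M e)

  upper,lower-injective : (e e' : Sec M) → upper e ≡ upper e' → lower e ≡ lower e' → e ≡ e'
  upper,lower-injective e e' u≡u' l≡l' =
    η,ζ-injective e e' (index-injective _ _ u≡u') (index-injective _ _ l≡l')

  span-bounds : (e : Sec M) → lower e ≤ upper e × upper e ≤ lower e + + M
  span-bounds e@(sec _ x y x≤y) with parity e
  ... | even k _ η≡ ζ≡ rewrite η≡ | ζ≡ = ℤP.+-monoʳ-≤ (k * + M) (+≤+ x≤y′) , (begin
    k * + M + + toℕ y          ≤⟨ ℤP.+-monoʳ-≤ (k * + M) (+≤+ (ℕP.≤-trans y≤M (ℕP.m≤n+m M (toℕ x)))) ⟩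
    k * + M + + (toℕ x ℕ.+ M)  ≡⟨ ℤP.+-assoc (k * + M) (+ toℕ x) (+ M) ⟨
    k * + M + + toℕ x + + M    ∎)
    where
    open ℤP.≤-Reasoning
    x≤y′ : x Fin.≤ y
    x≤y′ = recompute (x Fin.≤? y) x≤y
    y≤M : toℕ y ℕ.≤ M
    y≤M = ℕP.<⇒≤ (toℕ<n y)
  ... | odd k _ η≡ ζ≡ rewrite η≡ | ζ≡ = (begin
    k * + M + + toℕ y          ≤⟨ ℤP.+-monoʳ-≤ (k * + M) (+≤+ (ℕP.≤-trans y≤M (ℕP.m≤m+n M (toℕ x)))) ⟩
    k * + M + + (M ℕ.+ toℕ x)  ≡⟨ [k+1]*W+x≡k*W+[W+x] k (+ M) (+ toℕ x) ⟨
    (k + + 1) * + M + + toℕ x  ∎) , (begin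
    (k + + 1) * + M + + toℕ x  ≡⟨ [k+1]*W+x≡k*W+[W+x] k (+ M) (+ toℕ x) ⟩
    k * + M + + (M ℕ.+ toℕ x)  ≤⟨ ℤP.+-monoʳ-≤ (k * + M) (+≤+ (ℕP.+-monoʳ-≤ M x≤y′)) ⟩
    k * + M + + (M ℕ.+ toℕ y)  ≡⟨ cong (λ t → k * + M + + t) (ℕP.+-comm M (toℕ y)) ⟩
    k * + M + + (toℕ y ℕ.+ M)  ≡⟨ ℤP.+-assoc (k * + M) (+ toℕ y) (+ M) ⟨
    k * + M + + toℕ y + + M    ∎)
    where
    open ℤP.≤-Reasoning
    x≤y′ : x Fin.≤ y
    x≤y′ = recompute (x Fin.≤? y) x≤y
    y≤M : toℕ y ℕ.≤ M
    y≤M = ℕP.<⇒≤ (toℕ<n y)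

  fromInterval : (z : ℤ) (d : ℕ) → d ℕ.≤ M → Σ (Sec M) λ e → lower e ≡ z × upper e ≡ z + + d
  fromInterval z d d≤M with index-surjective z
  ... | (k , u) , refl with toℕ u ℕ.+ d ℕ.<? M
  ...   | yes u+d<M = sec (k * + 2) u v u≤v , cong index (proj₂ η,ζ≡) , (begin
    index (η M (sec (k * + 2) u v u≤v)) ≡⟨ cong index (proj₁ η,ζ≡) ⟩
    k * + M + + toℕ v                  ≡⟨ cong (λ t → k * + M + + t) (toℕ-fromℕ< u+d<M) ⟩
    k * + M + + (toℕ u ℕ.+ d)          ≡⟨ ℤP.+-assoc (k * + M) (+ toℕ u) (+ d) ⟨
    k * + M + + toℕ u + + d            ∎)
    where
    open ≡-Reasoning
    v : Fin M
    v = fromℕ< u+d<M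
    u≤v : u Fin.≤ v
    u≤v = subst (toℕ u ℕ.≤_) (sym (toℕ-fromℕ< u+d<M)) (ℕP.m≤m+n (toℕ u) d)
    η,ζ≡ : η M (sec (k * + 2) u v u≤v) ≡ (k , v) × ζ M (sec (k * + 2) u v u≤v) ≡ (k , u)
    η,ζ≡ = η,ζ-even k u v u≤v
  ...   | no u+d≮M = sec (k * + 2 + + 1) w u w≤u , cong index (proj₂ η,ζ≡) , (begin
    index (η M (sec (k * + 2 + + 1) w u w≤u)) ≡⟨ cong index (proj₁ η,ζ≡) ⟩
    (k + + 1) * + M + + toℕ w                ≡⟨ [k+1]*W+x≡k*W+[W+x] k (+ M) (+ toℕ w) ⟩
    k * + M + + (M ℕ.+ toℕ w)                ≡⟨ cong (λ t → k * + M + + t) M+w≡u+d ⟩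
    k * + M + + (toℕ u ℕ.+ d)                ≡⟨ ℤP.+-assoc (k * + M) (+ toℕ u) (+ d) ⟨
    k * + M + + toℕ u + + d                  ∎)
    where
    open ≡-Reasoning
    u+d∸M≤u : toℕ u ℕ.+ d ∸ M ℕ.≤ toℕ u
    u+d∸M≤u = ℕP.≤-trans (ℕP.∸-monoˡ-≤ M (ℕP.+-monoʳ-≤ (toℕ u) d≤M))
                         (ℕP.≤-reflexive (ℕP.m+n∸n≡m (toℕ u) M))
    w<M : toℕ u ℕ.+ d ∸ M ℕ.< M
    w<M = ℕP.≤-<-trans u+d∸M≤u (toℕ<n u)
    w : Fin M
    w = fromℕ< w<M
    w≤u : w Fin.≤ u
    w≤u = subst (ℕ._≤ toℕ u) (sym (toℕ-fromℕ< w<M)) u+d∸M≤u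
    M+w≡u+d : M ℕ.+ toℕ w ≡ toℕ u ℕ.+ d
    M+w≡u+d = trans (cong (M ℕ.+_) (toℕ-fromℕ< w<M)) (ℕP.m+[n∸m]≡n (ℕP.≮⇒≥ u+d≮M))
    η,ζ≡ : η M (sec (k * + 2 + + 1) w u w≤u) ≡ (k + + 1 , w) ×
           ζ M (sec (k * + 2 + + 1) w u w≤u) ≡ (k , u)
    η,ζ≡ = η,ζ-odd k w u w≤u

  -- Paths

  _⊑_ : Sec M → Sec M → Set
  e ⊑ e' = lower e' ≤ lower e × upper e ≤ upper e'

  ⊑-refl : ∀ {e} → e ⊑ e
  ⊑-refl = ℤP.≤-refl , ℤP.≤-refl

  ⊑-trans : ∀ {e e' e''} → e ⊑ e' → e' ⊑ e'' → e ⊑ e''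
  ⊑-trans (l'≤l , u≤u') (l''≤l' , u'≤u'') = ℤP.≤-trans l''≤l' l'≤l , ℤP.≤-trans u≤u' u'≤u''

  step⇒⊑ : (a b : Sec M) → IsD M a b ⊎ IsF M a b → a ⊑ b
  step⇒⊑ a b (inj₁ (η≡ , succ-ζ≡)) =
    ℤP.≤-trans (ℤP.i≤i+j (lower b) (+ 1))
               (ℤP.≤-reflexive (trans (sym (index-succ (ζ M b))) (cong index succ-ζ≡))) ,
    ℤP.≤-reflexive (cong index (sym η≡))
  step⇒⊑ a b (inj₂ (η≡ , ζ≡)) =
    ℤP.≤-reflexive (cong index ζ≡) ,
    ℤP.≤-trans (ℤP.i≤i+j (upper a) (+ 1))
               (ℤP.≤-reflexive (trans (sym (index-succ (η M a))) (cong index (sym η≡))))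

  path-⊑ : (P : Path M) {i j : Fin (suc M)} → i Fin.≤ j → Path.node P i ⊑ Path.node P j
  path-⊑ P = stepwise⇒monotone {_∼_ = _⊑_} (λ {e} → ⊑-refl {e}) (λ {e e′ e″} → ⊑-trans {e} {e′} {e″})
                                (Path.node P) (λ j → step⇒⊑ _ _ (Path.step P j))

  Separated : Sec M → Sec M → Set
  Separated e e' = upper e' < upper e × lower e' < lower e

  CommonPath : Sec M → Sec M → Set
  CommonPath e e' = ∃ λ (P : Path M) → _∈Path_ M e P × _∈Path_ M e' P

  separated⇒¬commonPath : ∀ {e e'} → Separated e e' → ¬ CommonPath e e'
  separated⇒¬commonPath (u'<u , l'<l) (P , (i , refl) , (j , refl)) with ≤-total i j
  ... | inj₁ i≤j = ℤP.<⇒≱ u'<u (proj₂ (path-⊑ P i≤j))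
  ... | inj₂ j≤i = ℤP.<⇒≱ l'<l (proj₁ (path-⊑ P j≤i))

  isF-from-bounds : (a b : Sec M) → upper b ≡ upper a + + 1 → lower b ≡ lower a → IsF M a b
  isF-from-bounds a b u≡ l≡ =
    index-injective _ _ (trans u≡ (sym (index-succ (η M a)))) , index-injective _ _ l≡

  isD-from-bounds : (a b : Sec M) → upper b ≡ upper a → lower b + + 1 ≡ lower a → IsD M a b
  isD-from-bounds a b u≡ l≡ = index-injective _ _ u≡ , index-injective _ _ (trans (index-succ (ζ M b)) l≡)

  latticeStep : ∀ z G G' t (a b : Sec M) →
                lower a ≡ z - + G → upper a ≡ z - + G + + t →
                lower b ≡ z - + G' → upper b ≡ z - + G' + + suc t →
                G' ≡ G ⊎ G' ≡ suc G → IsD M a b ⊎ IsF M a b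
  latticeStep z G .G t a b la ua lb ub (inj₁ refl) =
    inj₂ (isF-from-bounds a b (trans ub (trans (i+[1+j]≡i+j+1 (z - + G) (+ t)) (cong (_+ + 1) (sym ua))))
                              (trans lb (sym la)))
  latticeStep z G .(suc G) t a b la ua lb ub (inj₂ refl) =
    inj₁ (isD-from-bounds a b (trans ub (trans (i-[1+j]+[1+k]≡i-j+k z (+ G) (+ t)) (sym ua)))
                              (trans (cong (_+ + 1) lb) (trans (i-[1+j]+1≡i-j z (+ G)) (sym la))))

  latticeNode : ℤ → (ℕ → ℕ) → Fin (suc M) → Sec M
  latticeNode z g j = proj₁ (fromInterval (z - + g (toℕ j)) (toℕ j) (ℕP.≤-pred (toℕ<n j)))

  latticeNode-bounds : ∀ z g (j : Fin (suc M)) {t} → toℕ j ≡ t →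
                       lower (latticeNode z g j) ≡ z - + g t × upper (latticeNode z g j) ≡ z - + g t + + t
  latticeNode-bounds z g j refl = proj₂ (fromInterval (z - + g (toℕ j)) (toℕ j) (ℕP.≤-pred (toℕ<n j)))

  latticePath : ℤ → (g : ℕ → ℕ) → UnitSteps g → Path M
  Path.node (latticePath z g _) = latticeNode z g
  Path.step (latticePath z g g-steps) j =
    latticeStep z (g (toℕ j)) (g (suc (toℕ j))) (toℕ j) _ _
      (proj₁ before) (proj₂ before) (proj₁ after) (proj₂ after) (g-steps (toℕ j))
    where
    Bounds : Fin (suc M) → ℕ → Set
    Bounds j t = lower (latticeNode z g j) ≡ z - + g t × upper (latticeNode z g j) ≡ z - + g t + + t
    before : Bounds (inject₁ j) (toℕ j)
    before = latticeNode-bounds z g (inject₁ j) (toℕ-inject₁ j)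
    after : Bounds (Fin.suc j) (suc (toℕ j))
    after = latticeNode-bounds z g (Fin.suc j) refl

  latticePath-visits : ∀ z g g-steps {t} → t ℕ.≤ M → (e : Sec M) →
                       lower e ≡ z - + g t → upper e ≡ z - + g t + + t →
                       _∈Path_ M e (latticePath z g g-steps)
  latticePath-visits z g g-steps {t} t≤M e l≡ u≡ =
    j , upper,lower-injective _ _ (trans (proj₂ bounds) (sym u≡)) (trans (proj₁ bounds) (sym l≡))
    where
    j : Fin (suc M)
    j = fromℕ< (s≤s t≤M)
    bounds : lower (latticeNode z g j) ≡ z - + g t × upper (latticeNode z g j) ≡ z - + g t + + t
    bounds = latticeNode-bounds z g j (toℕ-fromℕ< (s≤s t≤M))

  ⊑⇒commonPath : (e e' : Sec M) → e' ⊑ e → CommonPath e e'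
  ⊑⇒commonPath e e' (l≤l' , u'≤u) =
    latticePath z g g-steps ,
    latticePath-visits z g g-steps T≤M e lower-e≡ upper-e≡ ,
    latticePath-visits z g g-steps A≤M e' lower-e'≡ upper-e'≡
    where
    z : ℤ
    z = lower e'
    A B C T : ℕ
    A = proj₁ (∃-gap (proj₁ (span-bounds e')))
    B = proj₁ (∃-gap l≤l')
    C = proj₁ (∃-gap u'≤u)
    T = A ℕ.+ (B ℕ.+ C)
    upper-e'≡z+A : upper e' ≡ z + + A
    upper-e'≡z+A = proj₂ (∃-gap (proj₁ (span-bounds e')))
    z≡lower-e+B : z ≡ lower e + + B
    z≡lower-e+B = proj₂ (∃-gap l≤l')
    upper-e≡upper-e'+C : upper e ≡ upper e' + + C
    upper-e≡upper-e'+C = proj₂ (∃-gap u'≤u)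

    g : ℕ → ℕ
    g = (_⊓ B) ∘ (_∸ A)
    g-steps : UnitSteps g
    g-steps = ∘-unitSteps (∸-unitSteps A) (⊓-unitSteps B)
    g[A]≡0 : g A ≡ 0
    g[A]≡0 = cong (_⊓ B) (ℕP.n∸n≡0 A)
    g[T]≡B : g T ≡ B
    g[T]≡B = trans (cong (_⊓ B) (ℕP.m+n∸m≡n A (B ℕ.+ C))) (ℕP.m≥n⇒m⊓n≡n (ℕP.m≤m+n B C))

    lower-e'≡ : lower e' ≡ z - + g A
    lower-e'≡ rewrite g[A]≡0 = sym (ℤP.+-identityʳ z)
    upper-e'≡ : upper e' ≡ z - + g A + + A
    upper-e'≡ rewrite g[A]≡0 | ℤP.+-identityʳ z = upper-e'≡z+A
    lower-e≡ : lower e ≡ z - + g T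
    lower-e≡ rewrite g[T]≡B = trans (i≡[i+j]-j (lower e) (+ B)) (cong (_- + B) (sym z≡lower-e+B))
    upper-e≡ : upper e ≡ z - + g T + + T
    upper-e≡ = begin
      upper e          ≡⟨ upper-e≡upper-e'+C ⟩
      upper e' + + C   ≡⟨ cong (_+ + C) upper-e'≡z+A ⟩
      z + + A + + C    ≡⟨ z+a+c≡z-b+[a+[b+c]] z (+ A) (+ B) (+ C) ⟩
      z - + B + + T    ≡⟨ cong (λ b → z - + b + + T) g[T]≡B ⟨
      z - + g T + + T  ∎
      where open ≡-Reasoning

    T≤M : T ℕ.≤ M
    T≤M = ℤP.drop‿+≤+ (Equivalence.from (+-monoʳ-≤-⇔ (lower e))
            (subst (_≤ lower e + + M) (trans upper-e≡ (cong (_+ + T) (sym lower-e≡))) (proj₂ (span-bounds e))))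
    A≤M : A ℕ.≤ M
    A≤M = ℕP.≤-trans (ℕP.m≤m+n A (B ℕ.+ C)) T≤M

  ≥S∧¬separated⇒⊑ : (e e' : Sec M) → _≥S_ M e e' → ¬ Separated e e' → e' ⊑ e
  ≥S∧¬separated⇒⊑ e e' (inj₁ η>η') ¬sep = ℤP.≮⇒≥ (λ l'<l → ¬sep (u'<u , l'<l)) , ℤP.<⇒≤ u'<u
    where
    u'<u : upper e' < upper e
    u'<u = Equivalence.to (>P⇔index< (η M e) (η M e')) η>η'
  ≥S∧¬separated⇒⊑ e e' (inj₂ (η≡η' , ζ'≥ζ)) _ =
    Equivalence.to (≥P⇔index≤ (ζ M e') (ζ M e)) ζ'≥ζ , ℤP.≤-reflexive (cong index (sym η≡η'))

  ≫ρ⇔separated : (e e' : Sec M) → _≫ρ_ M e e' ⇔ Separated e e'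
  ≫ρ⇔separated e e' =
    (>P⇔index< (η M e) (η M e') ×-⇔ >P⇔index< (ζ M e) (ζ M e')) ⇔-∘ ≫ρ⇔≻ e e'

  separated? : (e e' : Sec M) → Dec (Separated e e')
  separated? e e' = (upper e' ℤP.<? upper e) ×-dec (lower e' ℤP.<? lower e)

lemma5p7 : (m : ℕ) → m ≥ 1 → (e e' : Sec m) → _≥S_ m e e' →
    (_≫ρ_ m e e' ⇔ (¬ ∃ λ (P : Path m) → _∈Path_ m e P × _∈Path_ m e' P))
lemma5p7 (suc m') _ e e' e≥e' = mk⇔
  (separated⇒¬commonPath ∘ Equivalence.to (≫ρ⇔separated e e'))
  (λ ¬common → Equivalence.from (≫ρ⇔separated e e') (decidable-stable (separated? e e')
    (¬common ∘ ⊑⇒commonPath e e' ∘ ≥S∧¬separated⇒⊑ e e' e≥e')))
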